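{- Let $r\ge 1$, $n\ge1$, $m\ge0$ be integers and $c\in\{0,\dots,r-1\}$. The number of colored permutations in $G_{r,n}$ with exactly $m$ $(c,c)$-descents equals the number of colored permutations in $G_{r,n}$ with exactly $m$ $(0,0)$-descents.
   Context: $G_{r,n}$ is the set of words $\pi=\pi_1^{[c_1]}\cdots\pi_n^{[c_n]}$ with $\pi_1\cdots\pi_n$ a permutation of $\{1,\dots,n\}$ and colors $c_i\in\{0,\dots,r-1\}$, with order $a^{[i]}<b^{[j]}$ iff $i>j$, or $i=j$ and $a<b$. A $(c,c)$-descent of $\pi$ is an index $i\in\{1,\dots,n-1\}$ with $c_i=c_{i+1}=c$ and $\pi_i^{[c_i]}>\pi_{i+1}^{[c_{i+1}]}$ (equivalently $\pi_i>\pi_{i+1}$). -}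

module Defs where

open import Data.Nat using (ℕ; zero; suc; _+_)
open import Data.Fin using (Fin; _<_; _<?_)
open import Data.Fin.Properties using () renaming (_≟_ to _≟F_)
open import Data.Fin.Base using () renaming (_>_ to _>F_)
open import Data.List using (List; []; _∷_; map; concatMap; length; filter; allFin)
open import Data.Product using (_×_; _,_; proj₁; proj₂)
open import Data.List.Relation.Unary.Unique.Propositional using (Unique)
import Data.List.Relation.Unary.AllPairs as AllPairs
open import Relation.Nullary using (Dec; yes; no; ¬?; does)
open import Relation.Nullary.Decidable using (_×-dec_)
open import Relation.Binary.PropositionalEquality using (_≡_)
open import Data.Nat.Properties using () renaming (_≟_ to _≟ℕ_)
open import Data.Bool using (Bool; true; false; _∧_; if_then_else_)

-- A colored letter  a^[i]  : (a , i) with letter a ∈ Fin n (standing for a+1 ∈ {1..n})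
-- and color i ∈ Fin r.
Letter : ℕ → ℕ → Set
Letter r n = Fin n × Fin r

Word : ℕ → ℕ → Set
Word r n = List (Letter r n)

wordsOfLength : {A : Set} → List A → ℕ → List (List A)
wordsOfLength xs zero = [] ∷ []
wordsOfLength xs (suc k) = concatMap (λ x → map (x ∷_) (wordsOfLength xs k)) xs

-- All words of length n over colored letters of Fin n × Fin r
-- (candidates; colored permutations are those with distinct underlying letters).
allWords : (r n : ℕ) → List (Word r n)
allWords r n = wordsOfLength (concatMap (λ a → map (a ,_) (allFin r)) (allFin n)) n

-- π is a colored permutation in G_{r,n}: length n (ensured by enumeration) and
-- π₁⋯πₙ is a permutation of {1..n}, i.e. the underlying letters are distinct.
IsColoredPerm : {r n : ℕ} → Word r n → Set
IsColoredPerm w = Unique (map proj₁ w)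

isColoredPerm? : {r n : ℕ} → (w : Word r n) → Dec (IsColoredPerm w)
isColoredPerm? w = AllPairs.allPairs? (λ x y → ¬? (x ≟F y)) (map proj₁ w)

isCCDescent : {r n : ℕ} → Fin r → Letter r n → Letter r n → Bool
isCCDescent c (a , i) (b , j) = does (i ≟F c) ∧ does (j ≟F c) ∧ does (b <? a)

ccDes : {r n : ℕ} → Fin r → Word r n → ℕ
ccDes c [] = 0
ccDes c (x ∷ []) = 0
ccDes c (x ∷ y ∷ w) = (if isCCDescent c x y then 1 else 0) + ccDes c (y ∷ w)

countCCDes : (r n : ℕ) → Fin r → ℕ → ℕ
countCCDes r n c m =
  length (filter (λ w → isColoredPerm? w ×-dec (ccDes c w ≟ℕ m)) (allWords r n))

-- Recolouring every letter by a permutation τ of the colours is a bijection of G_{r,n} that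
-- keeps the underlying permutation and turns the (c,c)-descents of a word into the
-- (τ c,τ c)-descents of its image. Taking for τ the transposition of c and 0 gives the theorem.
module Submission where

open import Data.Bool using (true; false; _∧_; if_then_else_)
open import Data.Fin using (Fin; fromℕ<)
open import Data.Fin.Permutation using (Permutation′; _⟨$⟩ʳ_; transpose)
open import Data.Fin.Properties using () renaming (_≟_ to _≟F_)
open import Data.List using (List; []; _∷_; map; concatMap; length; filter; allFin)
open import Data.List.Properties using (map-∘; concatMap-cong; concatMap-map; map-concatMap)
open import Data.List.Membership.Propositional using (_∈_)
open import Data.List.Membership.Propositional.Properties using (∈-allFin; ∈-map⁺)
open import Data.List.Membership.Propositional.Properties.WithK using (unique∧set⇒bag)
open import Data.List.Relation.Binary.BagAndSetEquality using (∼bag⇒↭)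
open import Data.List.Relation.Binary.Permutation.Propositional as ↭ using (_↭_; ↭-refl; ↭-trans)
open import Data.List.Relation.Binary.Permutation.Propositional.Properties
  using (↭-length; ++⁺; ++⁺ˡ; shifts; filter-↭; map⁺)
open import Data.List.Relation.Unary.Unique.Propositional using (Unique)
import Data.List.Relation.Unary.Unique.Propositional.Properties as Unique
open import Data.Nat using (ℕ; _≤_; suc; _+_)
open import Data.Nat.Properties using () renaming (_≟_ to _≟ℕ_)
open import Data.Product using (_×_; _,_; proj₁; map₂)
open import Defs
open import Level using (0ℓ)
open import Function using (_↔_; Inverse; Injection; mk⇔)
open import Function.Properties.Inverse using (↔⇒↣)
open import Relation.Nullary using (does)
open import Relation.Nullary.Decidable using (_×-dec_; dec-true; does-⇔)
open import Relation.Unary using (Pred; Decidable)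
open import Relation.Binary.PropositionalEquality
  using (_≡_; refl; sym; trans; cong; cong₂; subst; module ≡-Reasoning)

module _ {A : Set} where

  map-↔-↭ : (f : A ↔ A) {xs : List A} → Unique xs → (∀ x → x ∈ xs) →
            map (Inverse.to f) xs ↭ xs
  map-↔-↭ f {xs} !xs complete =
    ∼bag⇒↭ (unique∧set⇒bag (Unique.map⁺ (Injection.injective (↔⇒↣ f)) !xs) !xs
                           (mk⇔ (λ _ → complete _) surjective))
    where
      open Inverse f using (to; from; strictlyInverseˡ)
      surjective : ∀ {z} → z ∈ xs → z ∈ map to xs
      surjective {z} _ =
        subst (_∈ map to xs) (strictlyInverseˡ z) (∈-map⁺ to (complete (from z)))

  length-filter-map : {P Q : Pred A 0ℓ} (P? : Decidable P) (Q? : Decidable Q) (f : A → A) →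
                      (∀ x → does (P? (f x)) ≡ does (Q? x)) → ∀ xs →
                      length (filter P? (map f xs)) ≡ length (filter Q? xs)
  length-filter-map P? Q? f P∘f≡Q [] = refl
  length-filter-map P? Q? f P∘f≡Q (x ∷ xs) with does (P? (f x)) | does (Q? x) | P∘f≡Q x
  ... | false | .false | refl = length-filter-map P? Q? f P∘f≡Q xs
  ... | true  | .true  | refl = cong suc (length-filter-map P? Q? f P∘f≡Q xs)

module _ {A B : Set} where

  concatMap⁺ : {f g : A → List B} → (∀ x → f x ↭ g x) →
               {xs ys : List A} → xs ↭ ys → concatMap f xs ↭ concatMap g ys
  concatMap⁺ {f} {g} f↭g {xs} xs↭ys = ↭-trans (pointwise xs) (alongList xs↭ys)
    where
      pointwise : ∀ xs → concatMap f xs ↭ concatMap g xs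
      pointwise []       = ↭-refl
      pointwise (x ∷ xs) = ++⁺ (f↭g x) (pointwise xs)
      alongList : ∀ {xs ys} → xs ↭ ys → concatMap g xs ↭ concatMap g ys
      alongList ↭.refl         = ↭-refl
      alongList (↭.prep x p)   = ++⁺ˡ (g x) (alongList p)
      alongList (↭.swap x y p) =
        ↭-trans (shifts (g x) (g y)) (++⁺ˡ (g y) (++⁺ˡ (g x) (alongList p)))
      alongList (↭.trans p q)  = ↭-trans (alongList p) (alongList q)

module _ {A : Set} where

  wordsOfLength-↭ : {xs ys : List A} → xs ↭ ys →
                    ∀ k → wordsOfLength xs k ↭ wordsOfLength ys k
  wordsOfLength-↭ xs↭ys 0       = ↭-refl
  wordsOfLength-↭ xs↭ys (suc k) =
    concatMap⁺ (λ x → map⁺ (x ∷_) (wordsOfLength-↭ xs↭ys k)) xs↭ys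

  map-wordsOfLength : (g : A → A) (xs : List A) → ∀ k →
                      map (map g) (wordsOfLength xs k) ≡ wordsOfLength (map g xs) k
  map-wordsOfLength g xs 0       = refl
  map-wordsOfLength g xs (suc k) = begin
    map (map g) (concatMap (λ x → map (x ∷_) (wordsOfLength xs k)) xs)
      ≡⟨ map-concatMap (map g) _ xs ⟩
    concatMap (λ x → map (map g) (map (x ∷_) (wordsOfLength xs k))) xs
      ≡⟨ concatMap-cong consMapped xs ⟩
    concatMap (λ x → map (g x ∷_) (wordsOfLength (map g xs) k)) xs
      ≡⟨ concatMap-map (λ y → map (y ∷_) (wordsOfLength (map g xs) k)) g xs ⟨
    concatMap (λ y → map (y ∷_) (wordsOfLength (map g xs) k)) (map g xs) ∎
    where
      open ≡-Reasoning
      consMapped : ∀ x → map (map g) (map (x ∷_) (wordsOfLength xs k))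
                       ≡ map (g x ∷_) (wordsOfLength (map g xs) k)
      consMapped x = begin
        map (map g) (map (x ∷_) (wordsOfLength xs k))   ≡⟨ map-∘ (wordsOfLength xs k) ⟨
        map (λ w → g x ∷ map g w) (wordsOfLength xs k)  ≡⟨ map-∘ (wordsOfLength xs k) ⟩
        map (g x ∷_) (map (map g) (wordsOfLength xs k)) ≡⟨ cong (map (g x ∷_)) (map-wordsOfLength g xs k) ⟩
        map (g x ∷_) (wordsOfLength (map g xs) k)       ∎

colouredLetters : (r n : ℕ) → List (Letter r n)
colouredLetters r n = concatMap (λ a → map (a ,_) (allFin r)) (allFin n)

module Recolouring {r n : ℕ} (τ : Permutation′ r) where

  recolour : Letter r n → Letter r n
  recolour = map₂ (τ ⟨$⟩ʳ_)

  map-allFin-↭ : map (τ ⟨$⟩ʳ_) (allFin r) ↭ allFin r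
  map-allFin-↭ = map-↔-↭ τ (Unique.allFin⁺ r) ∈-allFin

  map-recolour-colouredLetters : map recolour (colouredLetters r n) ↭ colouredLetters r n
  map-recolour-colouredLetters = subst (_↭ colouredLetters r n)
    (sym (map-concatMap recolour (λ a → map (a ,_) (allFin r)) (allFin n)))
    (concatMap⁺ recolourRow (↭-refl {x = allFin n}))
    where
      recolourRow : ∀ a → map recolour (map (a ,_) (allFin r)) ↭ map (a ,_) (allFin r)
      recolourRow a = subst (_↭ map (a ,_) (allFin r))
        (trans (sym (map-∘ (allFin r))) (map-∘ (allFin r)))
        (map⁺ (a ,_) map-allFin-↭)

  map-recolour-allWords : map (map recolour) (allWords r n) ↭ allWords r n
  map-recolour-allWords = subst (_↭ allWords r n)
    (sym (map-wordsOfLength recolour (colouredLetters r n) n))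
    (wordsOfLength-↭ map-recolour-colouredLetters n)

  does-recolour : ∀ c i → does (τ ⟨$⟩ʳ i ≟F τ ⟨$⟩ʳ c) ≡ does (i ≟F c)
  does-recolour c i = does-⇔ (mk⇔ (Injection.injective (↔⇒↣ τ)) (cong (τ ⟨$⟩ʳ_)))
                              (τ ⟨$⟩ʳ i ≟F τ ⟨$⟩ʳ c) (i ≟F c)

  isCCDescent-recolour : ∀ c x y →
    isCCDescent (τ ⟨$⟩ʳ c) (recolour x) (recolour y) ≡ isCCDescent c x y
  isCCDescent-recolour c (a , i) (b , j) =
    cong₂ (λ p q → p ∧ q ∧ _) (does-recolour c i) (does-recolour c j)

  ccDes-recolour : ∀ c w → ccDes (τ ⟨$⟩ʳ c) (map recolour w) ≡ ccDes c w
  ccDes-recolour c []          = refl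
  ccDes-recolour c (x ∷ [])    = refl
  ccDes-recolour c (x ∷ y ∷ w) = cong₂ _+_
    (cong (λ b → if b then 1 else 0) (isCCDescent-recolour c x y)) (ccDes-recolour c (y ∷ w))

  isColoredPerm?-recolour : ∀ w →
    does (isColoredPerm? (map recolour w)) ≡ does (isColoredPerm? w)
  isColoredPerm?-recolour w = does-⇔ (mk⇔ (subst Unique samePerm) (subst Unique (sym samePerm)))
    (isColoredPerm? (map recolour w)) (isColoredPerm? w)
    where
      samePerm : map proj₁ (map recolour w) ≡ map proj₁ w
      samePerm = sym (map-∘ w)

  countCCDes-recolour : ∀ m c → countCCDes r n (τ ⟨$⟩ʳ c) m ≡ countCCDes r n c m
  countCCDes-recolour m c = begin
    length (filter (hasDes (τ ⟨$⟩ʳ c)) (allWords r n))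
      ≡⟨ ↭-length (filter-↭ (hasDes (τ ⟨$⟩ʳ c)) map-recolour-allWords) ⟨
    length (filter (hasDes (τ ⟨$⟩ʳ c)) (map (map recolour) (allWords r n)))
      ≡⟨ length-filter-map (hasDes (τ ⟨$⟩ʳ c)) (hasDes c) (map recolour)
                           recolouredHasDes (allWords r n) ⟩
    length (filter (hasDes c) (allWords r n)) ∎
    where
      open ≡-Reasoning
      hasDes : (d : Fin r) → Decidable (λ w → IsColoredPerm w × ccDes d w ≡ m)
      hasDes d w = isColoredPerm? w ×-dec (ccDes d w ≟ℕ m)
      recolouredHasDes : ∀ w → does (hasDes (τ ⟨$⟩ʳ c) (map recolour w)) ≡ does (hasDes c w)
      recolouredHasDes w = cong₂ _∧_ (isColoredPerm?-recolour w)
                                     (cong (λ k → does (k ≟ℕ m)) (ccDes-recolour c w))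

transpose-source : ∀ {r} (i j : Fin r) → transpose i j ⟨$⟩ʳ i ≡ j
transpose-source i j rewrite dec-true (i ≟F i) refl = refl

mainTheorem10 : (r n m : ℕ) → (hr : 1 ≤ r) → 1 ≤ n → (c : Fin r) →
    countCCDes r n c m ≡ countCCDes r n (fromℕ< hr) m
mainTheorem10 r n m hr _ c = begin
  countCCDes r n c m           ≡⟨ countCCDes-recolour m c ⟨
  countCCDes r n (τ ⟨$⟩ʳ c) m  ≡⟨ cong (λ d → countCCDes r n d m) (transpose-source c (fromℕ< hr)) ⟩
  countCCDes r n (fromℕ< hr) m ∎
  where
    open ≡-Reasoning
    τ : Permutation′ r
    τ = transpose c (fromℕ< hr)
    open Recolouring {n = n} τ
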